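{- Let $L\ge 1$ and let $c_1,\dots,c_L$ be non-negative integers with $c_1\ge1$ and $c_L\ge1$, and let $\{G_n\}$ be a positive linear recurrence sequence with positive initial terms $G_1,\dots,G_L$ and $G_{n+1}=c_1G_n+\cdots+c_LG_{n+1-L}$. For $n\ge1$ let $H_n$ be the number of super-legal tuples $(a_1,\dots,a_n)$. Then $\lim_{n\to\infty}H_n/G_n$ exists and is positive.
   Context: A tuple $(a_1,\dots,a_n)$ of non-negative integers (representing $\sum_{i=1}^n a_iG_{n+1-i}$) is super-legal if there exists $s\in\{1,\dots,L\}$ such that $a_1=c_1,\dots,a_{s-1}=c_{s-1}$, $a_s<c_s$, $a_{s+1}=\cdots=a_{s+\ell}=0$ for some $\ell\ge0$, and the tuple $(a_{s+\ell+1},\dots,a_n)$ is either super-legal or empty. -}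

module Defs where

open import Data.Nat using (ℕ; zero; suc; _+_; _*_; _∸_; _≤_; _<_)
open import Data.Integer using (+_)
open import Data.Rational using (ℚ; _/_; 0ℚ)
open import Data.List using (List; []; _∷_; _++_; take; replicate; length)
open import Data.Vec using (Vec; toList; lookup)
open import Data.Fin using (Fin; toℕ)
open import Data.Product using (Σ; _×_)
open import Data.List.Relation.Unary.Unique.Propositional using (Unique)
open import Data.List.Membership.Propositional using (_∈_)
open import Function.Bundles using (_⇔_)

-- A block for index s = toℕ i + 1 is  c_1 ... c_{s-1} a_s 0^ℓ  with a_s < c_s;
-- the remaining tail is either empty or again super-legal.
data SuperLegal {L : ℕ} (c : Vec ℕ L) : List ℕ → Set where
  blockEnd  : (i : Fin L) (a ℓ : ℕ) → a < lookup c i →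
              SuperLegal c (take (toℕ i) (toList c) ++ (a ∷ replicate ℓ 0))
  blockMore : (i : Fin L) (a ℓ : ℕ) (rest : List ℕ) → a < lookup c i →
              SuperLegal c rest →
              SuperLegal c (take (toℕ i) (toList c) ++ (a ∷ replicate ℓ 0 ++ rest))

CountsSuperLegal : {L : ℕ} → Vec ℕ L → (ℕ → ℕ) → Set
CountsSuperLegal c H = ∀ n → 1 ≤ n →
  Σ (List (List ℕ)) λ xs → Unique xs × length xs ≡' H n ×
    (∀ t → (t ∈ xs) ⇔ (length t ≡' n × SuperLegal c t))
  where
  open import Relation.Binary.PropositionalEquality using () renaming (_≡_ to _≡'_)

linComb : List ℕ → (ℕ → ℕ) → ℕ → ℕ
linComb []       G m = 0
linComb (x ∷ cs) G m = x * G m + linComb cs G (m ∸ 1)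

-- a / b as a rational; junk value 0 when b = 0 (only used with b = G n > 0).
frac : ℕ → ℕ → ℚ
frac a zero    = 0ℚ
frac a (suc b) = (+ a) / suc b

-- Splitting off the first block c₁ … c_{s-1} a (a < c_s) of a super-legal tuple leaves a
-- super-legal tail, once the zeros closing the block are absorbed into it; hence for n ≥ L the
-- counts satisfy H (n + 1) = c₁ H n + ⋯ + c_L H (n + 1 - L), the recurrence of G.
--
-- For two solutions of this recurrence, an inequality α X_j ≤ β Y_j holding on L consecutive
-- indices holds forever (the coefficients are non-negative), and since c₁ ≥ 1 a slack
-- α X_t + z ≤ β Y_t persists as well.  Suppose a/T ≤ H_j/G_j ≤ (a + d)/T on a window ending
-- at t.  Comparing H_t/G_t with the midpoint gives a slack of d G_t/2 on one side; as G grows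
-- by a factor at most P over the next L steps, this improves that side of the bracket by d/(M T)
-- where M = 2P + 1, so the bracket shrinks by the factor (M - 1)/M.  Iterating, H_n/G_n is a
-- Cauchy sequence, and an initial window bounds it away from 0.

{-# OPTIONS --safe #-}
module Submission where

open import Defs
open import Data.Nat using (ℕ; suc; _+_; _≤_; _<_)
open import Data.Vec using (Vec; head; last; toList)
open import Data.Rational using (ℚ; _-_; ∣_∣; 0ℚ) renaming (_<_ to _<ℚ_; _≤_ to _≤ℚ_)
open import Data.Product using (Σ; _×_)
open import Relation.Binary.PropositionalEquality using (_≡_)

open import Data.Nat using (zero; _*_; _∸_; _^_; _⊔_; z≤n; s≤s; _≤?_; NonZero; >-nonZero)
open import Data.Nat.Properties
open import Data.Nat.ListAction using (sum)
open import Data.Nat.Tactic.RingSolver using (solve-∀)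
open import Data.Integer using (+_; +[1+_]; -[1+_])
import Data.Integer as ℤ
import Data.Integer.Properties as ℤ
open import Data.Integer.Tactic.RingSolver renaming (solve-∀ to ℤ-solve-∀)
open import Data.Rational using (mkℚ)
import Data.Rational as ℚ
import Data.Rational.Properties as ℚ
open import Data.Rational.Unnormalised using (mkℚᵘ) renaming (_≃_ to _≃ᵘ_)
import Data.Rational.Unnormalised as ℚᵘ
import Data.Rational.Unnormalised.Properties as ℚᵘ
open import Data.List using (List; []; _∷_; _++_; map; take; replicate; length; upTo; cartesianProductWith)
open import Data.List.Properties using (length-++; length-map; length-upTo; length-replicate; ∷-injective; ∷-injectiveʳ)
open import Data.List.Membership.Propositional using (_∈_)
open import Data.List.Membership.Propositional.Properties
  using (∈-map⁺; ∈-map⁻; ∈-++⁺ˡ; ∈-++⁺ʳ; ∈-++⁻; ∈-cartesianProductWith⁺; ∈-cartesianProductWith⁻;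
         ∈-upTo⁺; ∈-upTo⁻; ∈-length)
open import Data.List.Membership.Propositional.Properties.WithK using (unique∧set⇒bag)
open import Data.List.Relation.Unary.Unique.Propositional using (Unique)
import Data.List.Relation.Unary.Unique.Propositional.Properties as Unique
open import Data.List.Relation.Unary.AllPairs using ([])
open import Data.List.Relation.Binary.BagAndSetEquality using (∼bag⇒↭)
open import Data.List.Relation.Binary.Permutation.Propositional.Properties using (↭-length)
open import Data.Vec using ([]; _∷_; lookup)
open import Data.Fin using (Fin; toℕ; zero; suc)
open import Data.Fin.Properties using (toℕ<n)
open import Data.Product using (_,_; proj₁; proj₂)
open import Data.Sum using (_⊎_; inj₁; inj₂)
open import Function.Bundles using (_⇔_; mk⇔; Equivalence)
import Function.Properties.Equivalence as ⇔
open import Relation.Binary.PropositionalEquality using (refl; sym; trans; cong; cong₂; subst; subst₂; module ≡-Reasoning)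
open import Relation.Nullary using (¬_; contradiction; yes; no)
open import Algebra.Properties.CommutativeSemigroup *-commutativeSemigroup using (x∙yz≈y∙xz)
open import Algebra.Properties.AbelianGroup ℚ.+-0-abelianGroup using (⁻¹-anti-homo‿-)

*-distribˡ-linComb : ∀ {k} (cs : Vec ℕ k) (f : ℕ → ℕ) (p n : ℕ) →
                     p * linComb (toList cs) f n ≡ linComb (toList cs) (λ j → p * f j) n
*-distribˡ-linComb []       f p n = *-zeroʳ p
*-distribˡ-linComb (x ∷ cs) f p n = begin
  p * (x * f n + linComb (toList cs) f (n ∸ 1))         ≡⟨ *-distribˡ-+ p (x * f n) _ ⟩
  p * (x * f n) + p * linComb (toList cs) f (n ∸ 1)
    ≡⟨ cong₂ _+_ (x∙yz≈y∙xz p x (f n)) (*-distribˡ-linComb cs f p (n ∸ 1)) ⟩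
  x * (p * f n) + linComb (toList cs) (λ j → p * f j) (n ∸ 1) ∎
  where open ≡-Reasoning

linComb-mono : ∀ {k} (cs : Vec ℕ k) {f g : ℕ → ℕ} n → (∀ i → i < k → f (n ∸ i) ≤ g (n ∸ i)) →
               linComb (toList cs) f n ≤ linComb (toList cs) g n
linComb-mono []       n f≤g = ≤-refl
linComb-mono {suc k} (x ∷ cs) {f} {g} n f≤g =
  +-mono-≤ (*-monoʳ-≤ x (f≤g 0 (s≤s z≤n))) (linComb-mono cs (n ∸ 1) tail≤)
  where
  tail≤ : ∀ i → i < k → f (n ∸ 1 ∸ i) ≤ g (n ∸ 1 ∸ i)
  tail≤ i i<k = subst (λ j → f j ≤ g j) (sym (∸-+-assoc n 1 i)) (f≤g (suc i) (s≤s i<k))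

linComb-cong : ∀ {k} (cs : Vec ℕ k) {f g : ℕ → ℕ} n → (∀ i → i < k → f (n ∸ i) ≡ g (n ∸ i)) →
               linComb (toList cs) f n ≡ linComb (toList cs) g n
linComb-cong cs n f≡g = ≤-antisym (linComb-mono cs n λ i i<k → ≤-reflexive (f≡g i i<k))
                                  (linComb-mono cs n λ i i<k → ≤-reflexive (sym (f≡g i i<k)))

linComb-const : ∀ {k} (cs : Vec ℕ k) (v n : ℕ) → linComb (toList cs) (λ _ → v) n ≡ sum (toList cs) * v
linComb-const []       v n = refl
linComb-const (x ∷ cs) v n = begin
  x * v + linComb (toList cs) (λ _ → v) (n ∸ 1) ≡⟨ cong (_+_ (x * v)) (linComb-const cs v (n ∸ 1)) ⟩
  x * v + sum (toList cs) * v                   ≡⟨ *-distribʳ-+ v x (sum (toList cs)) ⟨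
  (x + sum (toList cs)) * v                     ∎
  where open ≡-Reasoning

-- Enumerating tuples by their first block

Unique∧set⇒length≡ : {A : Set} {xs ys : List A} → Unique xs → Unique ys →
                     (∀ {z} → z ∈ xs ⇔ z ∈ ys) → length xs ≡ length ys
Unique∧set⇒length≡ xs! ys! xs≈ys = ↭-length (∼bag⇒↭ (unique∧set⇒bag xs! ys! xs≈ys))

length-cartesianProductWith : {A B C : Set} (f : A → B → C) (xs : List A) (ys : List B) →
                              length (cartesianProductWith f xs ys) ≡ length xs * length ys
length-cartesianProductWith f []       ys = refl
length-cartesianProductWith f (x ∷ xs) ys = begin
  length (map (f x) ys ++ cartesianProductWith f xs ys)         ≡⟨ length-++ (map (f x) ys) ⟩
  length (map (f x) ys) + length (cartesianProductWith f xs ys)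
    ≡⟨ cong₂ _+_ (length-map (f x) ys) (length-cartesianProductWith f xs ys) ⟩
  length ys + length xs * length ys                             ∎
  where open ≡-Reasoning

data StartsWithBlock {k} (cs : Vec ℕ k) (P : Fin k → List ℕ → Set) : List ℕ → Set where
  block : ∀ i a {t} → a < lookup cs i → P i t → StartsWithBlock cs P (take (toℕ i) (toList cs) ++ a ∷ t)

StartsWithBlock-cong : ∀ {k} {cs : Vec ℕ k} {P Q : Fin k → List ℕ → Set} →
                       (∀ {i t} → P i t ⇔ Q i t) → ∀ {t} → StartsWithBlock cs P t ⇔ StartsWithBlock cs Q t
StartsWithBlock-cong P⇔Q = mk⇔ (λ { (block i a a<cᵢ p) → block i a a<cᵢ (Equivalence.to P⇔Q p) })
                               (λ { (block i a a<cᵢ q) → block i a a<cᵢ (Equivalence.from P⇔Q q) })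

length-block : ∀ {k} (cs : Vec ℕ k) (i : Fin k) a t →
               length (take (toℕ i) (toList cs) ++ a ∷ t) ≡ toℕ i + suc (length t)
length-block (x ∷ cs) zero    a t = refl
length-block (x ∷ cs) (suc i) a t = cong suc (length-block cs i a t)

withBlock : ∀ {k} → Vec ℕ k → (ℕ → List (List ℕ)) → ℕ → List (List ℕ)
withBlock []       tails m = []
withBlock (x ∷ cs) tails m =
  cartesianProductWith _∷_ (upTo x) (tails m) ++ map (x ∷_) (withBlock cs tails (m ∸ 1))

∈-withBlock⇔ : ∀ {k} (cs : Vec ℕ k) tails m {t} →
               t ∈ withBlock cs tails m ⇔ StartsWithBlock cs (λ i t′ → t′ ∈ tails (m ∸ toℕ i)) t
∈-withBlock⇔ cs tails m = mk⇔ (to cs m) (from cs m)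
  where
  shift : ∀ m j {t′} → t′ ∈ tails (m ∸ 1 ∸ j) → t′ ∈ tails (m ∸ suc j)
  shift m j {t′} = subst (λ n → t′ ∈ tails n) (∸-+-assoc m 1 j)

  unshift : ∀ m j {t′} → t′ ∈ tails (m ∸ suc j) → t′ ∈ tails (m ∸ 1 ∸ j)
  unshift m j {t′} = subst (λ n → t′ ∈ tails n) (sym (∸-+-assoc m 1 j))

  to : ∀ {k} (cs : Vec ℕ k) m {t} → t ∈ withBlock cs tails m →
       StartsWithBlock cs (λ i t′ → t′ ∈ tails (m ∸ toℕ i)) t
  to (x ∷ cs) m t∈ with ∈-++⁻ (cartesianProductWith _∷_ (upTo x) (tails m)) t∈
  ... | inj₁ t∈× with ∈-cartesianProductWith⁻ _∷_ (upTo x) (tails m) t∈×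
  ...   | a , t′ , a∈ , t′∈ , refl = block zero a (∈-upTo⁻ a∈) t′∈
  to (x ∷ cs) m t∈ | inj₂ t∈map with ∈-map⁻ (x ∷_) t∈map
  ... | u , u∈ , refl with to cs (m ∸ 1) u∈
  ...   | block i a a<cᵢ t′∈ = block (suc i) a a<cᵢ (shift m (toℕ i) t′∈)

  from : ∀ {k} (cs : Vec ℕ k) m {t} → StartsWithBlock cs (λ i t′ → t′ ∈ tails (m ∸ toℕ i)) t →
         t ∈ withBlock cs tails m
  from (x ∷ cs) m (block zero    a a<x  t′∈) = ∈-++⁺ˡ (∈-cartesianProductWith⁺ _∷_ (∈-upTo⁺ a<x) t′∈)
  from (x ∷ cs) m (block (suc i) a a<cᵢ t′∈) =
    ∈-++⁺ʳ _ (∈-map⁺ (x ∷_) (from cs (m ∸ 1) (block i a a<cᵢ (unshift m (toℕ i) t′∈))))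

Unique-withBlock : ∀ {k} (cs : Vec ℕ k) tails m → (∀ n → Unique (tails n)) → Unique (withBlock cs tails m)
Unique-withBlock []       tails m tails! = []
Unique-withBlock (x ∷ cs) tails m tails! =
  Unique.++⁺ (Unique.cartesianProductWith⁺ _∷_ ∷-injective (Unique.upTo⁺ x) (tails! m))
             (Unique.map⁺ ∷-injectiveʳ (Unique-withBlock cs tails (m ∸ 1) tails!))
             disjoint
  where
  disjoint : ∀ {v} → ¬ (v ∈ cartesianProductWith _∷_ (upTo x) (tails m) ×
                        v ∈ map (x ∷_) (withBlock cs tails (m ∸ 1)))
  disjoint (v∈× , v∈map) with ∈-cartesianProductWith⁻ _∷_ (upTo x) (tails m) v∈× | ∈-map⁻ (x ∷_) v∈map
  ... | a , _ , a∈ , _ , refl | _ , _ , a∷≡x∷ = <-irrefl (proj₁ (∷-injective a∷≡x∷)) (∈-upTo⁻ a∈)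

length-withBlock : ∀ {k} (cs : Vec ℕ k) tails m →
                   length (withBlock cs tails m) ≡ linComb (toList cs) (λ n → length (tails n)) m
length-withBlock []       tails m = refl
length-withBlock (x ∷ cs) tails m = begin
  length (blocks ++ map (x ∷_) rest)         ≡⟨ length-++ blocks ⟩
  length blocks + length (map (x ∷_) rest)
    ≡⟨ cong₂ _+_ (length-cartesianProductWith _∷_ (upTo x) (tails m)) (length-map (x ∷_) rest) ⟩
  length (upTo x) * length (tails m) + length rest
    ≡⟨ cong₂ _+_ (cong (_* length (tails m)) (length-upTo x)) (length-withBlock cs tails (m ∸ 1)) ⟩
  x * length (tails m) + linComb (toList cs) (λ n → length (tails n)) (m ∸ 1) ∎
  where
  open ≡-Reasoning
  blocks rest : List (List ℕ)
  blocks = cartesianProductWith _∷_ (upTo x) (tails m)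
  rest   = withBlock cs tails (m ∸ 1)

+-suc≡suc⇔≡∸ : ∀ {i l m} → i ≤ m → i + suc l ≡ suc m ⇔ l ≡ m ∸ i
+-suc≡suc⇔≡∸ {i} {l} {m} i≤m = mk⇔ to from
  where
  to : i + suc l ≡ suc m → l ≡ m ∸ i
  to eq = trans (sym (m+n∸m≡n i l)) (cong (_∸ i) (suc-injective (trans (sym (+-suc i l)) eq)))
  from : l ≡ m ∸ i → i + suc l ≡ suc m
  from refl = trans (+-suc i (m ∸ i)) (cong suc (m+[n∸m]≡n i≤m))

module SuperLegalTuples {K} (x₀ : ℕ) (cs : Vec ℕ K) (0<x₀ : 0 < x₀) where

  c : Vec ℕ (suc K)
  c = x₀ ∷ cs

  zeros-superLegal : ∀ ℓ → SuperLegal c (replicate (suc ℓ) 0)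
  zeros-superLegal ℓ = blockEnd zero 0 ℓ 0<x₀

  -- The zeros closing a block form a block of their own (s = 1, a = 0 < c₁), so they join the tail.
  superLegal⇒startsWithBlock : ∀ {t} → SuperLegal c t →
                               StartsWithBlock c (λ _ t′ → t′ ≡ [] ⊎ SuperLegal c t′) t
  superLegal⇒startsWithBlock (blockEnd  i a zero         a<cᵢ)   = block i a a<cᵢ (inj₁ refl)
  superLegal⇒startsWithBlock (blockEnd  i a (suc ℓ)      a<cᵢ)   = block i a a<cᵢ (inj₂ (zeros-superLegal ℓ))
  superLegal⇒startsWithBlock (blockMore i a zero    rest a<cᵢ r) = block i a a<cᵢ (inj₂ r)
  superLegal⇒startsWithBlock (blockMore i a (suc ℓ) rest a<cᵢ r) =
    block i a a<cᵢ (inj₂ (blockMore zero 0 ℓ rest 0<x₀ r))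

  superLegal-nonempty : ∀ {t} → SuperLegal c t → 0 < length t
  superLegal-nonempty s with superLegal⇒startsWithBlock s
  ... | block i a {t′} _ _ =
    subst (0 <_) (sym (length-block c i a t′)) (≤-trans (s≤s z≤n) (m≤n+m (suc (length t′)) (toℕ i)))

  SuperLegalOfLength : ℕ → List ℕ → Set
  SuperLegalOfLength n t = length t ≡ n × SuperLegal c t

  superLegalOfLength⇔ : ∀ {m t} → suc K ≤ m →
    SuperLegalOfLength (suc m) t ⇔ StartsWithBlock c (λ i t′ → SuperLegalOfLength (m ∸ toℕ i) t′) t
  superLegalOfLength⇔ {m} L≤m = mk⇔ to from
    where
    i<m : ∀ i → toℕ i < m
    i<m i = <-≤-trans (toℕ<n i) L≤m

    tail-length : ∀ i a t′ → length (take (toℕ i) (toList c) ++ a ∷ t′) ≡ suc m ⇔ length t′ ≡ m ∸ toℕ i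
    tail-length i a t′ = ⇔.trans (mk⇔ (trans (sym (length-block c i a t′))) (trans (length-block c i a t′)))
                                 (+-suc≡suc⇔≡∸ (<⇒≤ (i<m i)))

    to : ∀ {t} → SuperLegalOfLength (suc m) t →
         StartsWithBlock c (λ i t′ → SuperLegalOfLength (m ∸ toℕ i) t′) t
    to (len , s) with superLegal⇒startsWithBlock s
    ... | block i a {t′} a<cᵢ (inj₁ refl) =
      contradiction (Equivalence.to (tail-length i a t′) len) (<⇒≢ (m<n⇒0<n∸m (i<m i)))
    ... | block i a {t′} a<cᵢ (inj₂ s′) = block i a a<cᵢ (Equivalence.to (tail-length i a t′) len , s′)

    from : ∀ {t} → StartsWithBlock c (λ i t′ → SuperLegalOfLength (m ∸ toℕ i) t′) t →
           SuperLegalOfLength (suc m) t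
    from (block i a {t′} a<cᵢ (len , s′)) = Equivalence.from (tail-length i a t′) len , blockMore i a 0 t′ a<cᵢ s′

  module Counting (H : ℕ → ℕ) (counts : CountsSuperLegal c H) where

    tuples : ℕ → List (List ℕ)
    tuples zero    = []
    tuples (suc n) = proj₁ (counts (suc n) (s≤s z≤n))

    Unique-tuples : ∀ n → Unique (tuples n)
    Unique-tuples zero    = []
    Unique-tuples (suc n) = proj₁ (proj₂ (counts (suc n) (s≤s z≤n)))

    length-tuples : ∀ n → 0 < n → length (tuples n) ≡ H n
    length-tuples (suc n) _ = proj₁ (proj₂ (proj₂ (counts (suc n) (s≤s z≤n))))

    ∈-tuples⇔ : ∀ n {t} → t ∈ tuples n ⇔ SuperLegalOfLength n t
    ∈-tuples⇔ zero    = mk⇔ (λ ()) (λ (len , s) → contradiction (sym len) (<⇒≢ (superLegal-nonempty s)))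
    ∈-tuples⇔ (suc n) = proj₂ (proj₂ (proj₂ (counts (suc n) (s≤s z≤n)))) _

    count-pos : ∀ n → 0 < n → 0 < H n
    count-pos (suc m) 0<n = subst (0 <_) (length-tuples (suc m) 0<n)
      (∈-length (Equivalence.from (∈-tuples⇔ (suc m)) (length-replicate (suc m) , zeros-superLegal m)))

    count-recurrent : ∀ m → suc K ≤ m → H (suc m) ≡ linComb (toList c) H m
    count-recurrent m L≤m = begin
      H (suc m)                                      ≡⟨ length-tuples (suc m) (s≤s z≤n) ⟨
      length (tuples (suc m))
        ≡⟨ Unique∧set⇒length≡ (Unique-tuples (suc m)) (Unique-withBlock c tuples m Unique-tuples) ∈-tuples⇔withBlock ⟩
      length (withBlock c tuples m)                  ≡⟨ length-withBlock c tuples m ⟩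
      linComb (toList c) (λ n → length (tuples n)) m
        ≡⟨ linComb-cong c m (λ i i<L → length-tuples (m ∸ i) (m<n⇒0<n∸m (<-≤-trans i<L L≤m))) ⟩
      linComb (toList c) H m                         ∎
      where
      open ≡-Reasoning
      ∈-tuples⇔withBlock : ∀ {t} → t ∈ tuples (suc m) ⇔ t ∈ withBlock c tuples m
      ∈-tuples⇔withBlock =
        ⇔.trans (∈-tuples⇔ (suc m)) (⇔.trans (superLegalOfLength⇔ L≤m)
          (⇔.trans (StartsWithBlock-cong (⇔.sym (∈-tuples⇔ _))) (⇔.sym (∈-withBlock⇔ c tuples m))))

bounded-up-to : ∀ (f : ℕ → ℕ) n → Σ ℕ λ B → ∀ j → j ≤ n → f j ≤ B
bounded-up-to f zero    = f 0 , λ { zero z≤n → ≤-refl }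
bounded-up-to f (suc n) with bounded-up-to f n
... | B , f≤B = B ⊔ f (suc n) , bound
  where
  bound : ∀ j → j ≤ suc n → f j ≤ B ⊔ f (suc n)
  bound j j≤1+n with m≤n⇒m<n∨m≡n j≤1+n
  ... | inj₁ j<1+n = ≤-trans (f≤B j (≤-pred j<1+n)) (m≤m⊔n B (f (suc n)))
  ... | inj₂ refl  = m≤n⊔m B (f (suc n))

-- Bernoulli's inequality (1 + 1/m)ᵏ ≥ 1 + k/m, multiplied by mᵏ⁺¹.
bernoulli : ∀ m k → m ^ k * (m + k) ≤ m * suc m ^ k
bernoulli m zero    = ≤-reflexive (base m)
  where
  base : ∀ m → 1 * (m + 0) ≡ m * 1
  base = solve-∀
bernoulli m (suc k) = begin
  m ^ suc k * (m + suc k)             ≡⟨ split m (m ^ k) k ⟩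
  m * (m ^ k * (m + k)) + m * m ^ k
    ≤⟨ +-mono-≤ (*-monoʳ-≤ m (bernoulli m k)) (*-monoʳ-≤ m (^-monoˡ-≤ k (n≤1+n m))) ⟩
  m * (m * suc m ^ k) + m * suc m ^ k ≡⟨ merge m (suc m ^ k) ⟩
  m * suc m ^ suc k                   ∎
  where
  open ≤-Reasoning
  split : ∀ m p k → m * p * (m + suc k) ≡ m * (p * (m + k)) + m * p
  split = solve-∀
  merge : ∀ m q → m * (m * q) + m * q ≡ m * ((1 + m) * q)
  merge = solve-∀

[1+m]^k-outgrows-m^k : ∀ m C → Σ ℕ λ k → C * m ^ k < suc m ^ k
[1+m]^k-outgrows-m^k m C = k , *-cancelˡ-< k (C * m ^ k) (suc m ^ k) (begin-strict
  k * (C * m ^ k)       ≡⟨ rearrange k C (m ^ k) ⟩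
  C * (m ^ k * k)       ≤⟨ *-monoʳ-≤ C (*-monoʳ-≤ (m ^ k) (m≤n+m k m)) ⟩
  C * (m ^ k * (m + k)) ≤⟨ *-monoʳ-≤ C (bernoulli m k) ⟩
  C * (m * suc m ^ k)   ≡⟨ *-assoc C m (suc m ^ k) ⟨
  C * m * suc m ^ k     <⟨ +-monoˡ-≤ (C * m * suc m ^ k) (m^n>0 (suc m) k) ⟩
  k * suc m ^ k         ∎)
  where
  open ≤-Reasoning
  k : ℕ
  k = suc (C * m)
  rearrange : ∀ k C p → k * (C * p) ≡ C * (p * k)
  rearrange = solve-∀

-- In ratio form: a/T ≤ Hn/Gn, Hm/Gm ≤ (a + d)/T and d/T < 1/E give Hm/Gm − Hn/Gn < 1/E.
bracketed-ratios-close : ∀ T a d E {Hm Gm Hn Gn} → 0 < Gm → 0 < Gn → E * d < T →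
                         T * Hm ≤ (a + d) * Gm → a * Gn ≤ T * Hn → E * Hm * Gn < E * Hn * Gm + Gm * Gn
bracketed-ratios-close T a d E {Hm} {Gm} {Hn} {Gn} 0<Gm 0<Gn Ed<T Hm≤ Hn≥ =
  *-cancelˡ-< T _ _ (begin-strict
    T * (E * Hm * Gn)                     ≡⟨ e₁ T E Hm Gn ⟩
    E * Gn * (T * Hm)                     ≤⟨ *-monoʳ-≤ (E * Gn) Hm≤ ⟩
    E * Gn * ((a + d) * Gm)               ≡⟨ e₂ E Gn a d Gm ⟩
    E * Gm * (a * Gn) + E * d * (Gm * Gn)
      <⟨ +-monoʳ-< (E * Gm * (a * Gn)) (*-monoˡ-< (Gm * Gn) {{GmGn-nonZero}} Ed<T) ⟩
    E * Gm * (a * Gn) + T * (Gm * Gn)     ≤⟨ +-monoˡ-≤ (T * (Gm * Gn)) (*-monoʳ-≤ (E * Gm) Hn≥) ⟩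
    E * Gm * (T * Hn) + T * (Gm * Gn)     ≡⟨ e₃ T E Hn Gm Gn ⟩
    T * (E * Hn * Gm + Gm * Gn)           ∎)
  where
  open ≤-Reasoning
  GmGn-nonZero : NonZero (Gm * Gn)
  GmGn-nonZero = >-nonZero (*-mono-≤ 0<Gm 0<Gn)
  e₁ : ∀ T E h g → T * (E * h * g) ≡ E * g * (T * h)
  e₁ = solve-∀
  e₂ : ∀ E gn a d gm → E * gn * ((a + d) * gm) ≡ E * gm * (a * gn) + E * d * (gm * gn)
  e₂ = solve-∀
  e₃ : ∀ T E hn gm gn → E * gm * (T * hn) + T * (gm * gn) ≡ T * (E * hn * gm + gm * gn)
  e₃ = solve-∀

m+2n≤2o⇒m≤2[o∸n] : ∀ m n o → m + 2 * n ≤ 2 * o → m ≤ 2 * (o ∸ n)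
m+2n≤2o⇒m≤2[o∸n] m n o h = subst (m ≤_) (sym (*-distribˡ-∸ 2 o n)) (m+n≤o⇒m≤o∸n m h)

toℚᵘ-frac : ∀ A b → ℚ.toℚᵘ (frac A (suc b)) ≃ᵘ mkℚᵘ (+ A) b
toℚᵘ-frac A b = ℚ.toℚᵘ-fromℚᵘ (mkℚᵘ (+ A) b)

+*+-≤ : ∀ m n p q → m * n ≤ p * q → + m ℤ.* + n ℤ.≤ + p ℤ.* + q
+*+-≤ m n p q h = subst₂ ℤ._≤_ (ℤ.pos-* m n) (ℤ.pos-* p q) (ℤ.+≤+ h)

+*+-< : ∀ m n p q → m * n < p * q → + m ℤ.* + n ℤ.< + p ℤ.* + q
+*+-< m n p q h = subst₂ ℤ._<_ (ℤ.pos-* m n) (ℤ.pos-* p q) (ℤ.+<+ h)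

frac-≤ : ∀ A B A′ B′ → 0 < B → 0 < B′ → A * B′ ≤ A′ * B → frac A B ≤ℚ frac A′ B′
frac-≤ A (suc b) A′ (suc b′) _ _ h = ℚ.toℚᵘ-cancel-≤
  (ℚᵘ.≤-respʳ-≃ (ℚᵘ.≃-sym (toℚᵘ-frac A′ b′))
    (ℚᵘ.≤-respˡ-≃ (ℚᵘ.≃-sym (toℚᵘ-frac A b)) (ℚᵘ.*≤* (+*+-≤ A (suc b′) A′ (suc b) h))))

frac-pos : ∀ A B → 0 < A → 0 < B → 0ℚ <ℚ frac A B
frac-pos A (suc b) 0<A _ = ℚ.toℚᵘ-cancel-<
  (ℚᵘ.<-respʳ-≃ (ℚᵘ.≃-sym (toℚᵘ-frac A b))
    (ℚᵘ.*<* (+*+-< 0 (suc b) A 1 (subst (0 <_) (sym (*-identityʳ A)) 0<A))))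

unitFraction-below : ∀ ε → 0ℚ <ℚ ε → Σ ℕ λ e → frac 1 (suc e) ≤ℚ ε
unitFraction-below (mkℚ +[1+ p ] e _) _ = e , ℚ.toℚᵘ-cancel-≤
  (ℚᵘ.≤-respˡ-≃ (ℚᵘ.≃-sym (toℚᵘ-frac 1 e))
    (ℚᵘ.*≤* (+*+-≤ 1 (suc e) (suc p) (suc e) (*-monoˡ-≤ (suc e) (s≤s (z≤n {p}))))))
unitFraction-below (mkℚ (+ 0)    _ _) (ℚ.*<* (ℤ.+<+ ()))
unitFraction-below (mkℚ -[1+ _ ] _ _) (ℚ.*<* ())

cross-multiplied-< : ∀ E A B A′ B′ → E * A * B′ < E * A′ * B + B * B′ →
  (+ A ℤ.* + B′ ℤ.+ ℤ.- + A′ ℤ.* + B) ℤ.* + E ℤ.< + 1 ℤ.* + (B * B′)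
cross-multiplied-< E A B A′ B′ h = begin-strict
  (+ A ℤ.* + B′ ℤ.+ ℤ.- + A′ ℤ.* + B) ℤ.* + E       ≡⟨ expand (+ A) (+ B′) (+ A′) (+ B) (+ E) ⟩
  + E ℤ.* + A ℤ.* + B′ ℤ.- + E ℤ.* + A′ ℤ.* + B     ≡⟨ cong₂ ℤ._-_ (pos-*³ E A B′) (pos-*³ E A′ B) ⟨
  + (E * A * B′) ℤ.- + (E * A′ * B)                 <⟨ ℤ.+-monoˡ-< (ℤ.- + (E * A′ * B)) (ℤ.+<+ h) ⟩
  + (E * A′ * B + B * B′) ℤ.- + (E * A′ * B)
    ≡⟨ cong (ℤ._- + (E * A′ * B)) (ℤ.pos-+ (E * A′ * B) (B * B′)) ⟩
  + (E * A′ * B) ℤ.+ + (B * B′) ℤ.- + (E * A′ * B)  ≡⟨ cancel (+ (E * A′ * B)) (+ (B * B′)) ⟩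
  + (B * B′)                                        ≡⟨ ℤ.*-identityˡ (+ (B * B′)) ⟨
  + 1 ℤ.* + (B * B′)                                ∎
  where
  open ℤ.≤-Reasoning
  pos-*³ : ∀ a b c → + (a * b * c) ≡ + a ℤ.* + b ℤ.* + c
  pos-*³ a b c = trans (ℤ.pos-* (a * b) c) (cong (ℤ._* + c) (ℤ.pos-* a b))
  expand : ∀ a b′ a′ b e →
           (a ℤ.* b′ ℤ.+ ℤ.- a′ ℤ.* b) ℤ.* e ≡ e ℤ.* a ℤ.* b′ ℤ.- e ℤ.* a′ ℤ.* b
  expand = ℤ-solve-∀
  cancel : ∀ x y → x ℤ.+ y ℤ.- x ≡ y
  cancel = ℤ-solve-∀

frac-sub-< : ∀ E A B A′ B′ → 0 < E → 0 < B → 0 < B′ → E * A * B′ < E * A′ * B + B * B′ →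
             frac A B - frac A′ B′ <ℚ frac 1 E
frac-sub-< (suc e) A (suc b) A′ (suc b′) _ _ _ h = ℚ.toℚᵘ-cancel-<
  (ℚᵘ.<-respʳ-≃ (ℚᵘ.≃-sym (toℚᵘ-frac 1 e))
    (ℚᵘ.<-respˡ-≃ (ℚᵘ.≃-sym difference) (ℚᵘ.*<* (cross-multiplied-< (suc e) A (suc b) A′ (suc b′) h))))
  where
  difference : ℚ.toℚᵘ (frac A (suc b) - frac A′ (suc b′)) ≃ᵘ mkℚᵘ (+ A) b ℚᵘ.- mkℚᵘ (+ A′) b′
  difference = ℚᵘ.≃-trans (ℚ.toℚᵘ-homo-+ (frac A (suc b)) (ℚ.- frac A′ (suc b′)))
    (ℚᵘ.+-cong (toℚᵘ-frac A b)
      (ℚᵘ.≃-trans (ℚ.toℚᵘ-homo‿- (frac A′ (suc b′))) (ℚᵘ.-‿cong (toℚᵘ-frac A′ b′))))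

∣p-q∣<r : ∀ p q {r} → p - q <ℚ r → q - p <ℚ r → ∣ p - q ∣ <ℚ r
∣p-q∣<r p q {r} p-q<r q-p<r with ℚ.∣p∣≡p∨∣p∣≡-p (p - q)
... | inj₁ ∣p-q∣≡p-q    = subst (_<ℚ r) (sym ∣p-q∣≡p-q) p-q<r
... | inj₂ ∣p-q∣≡-[p-q] = subst (_<ℚ r) (sym (trans ∣p-q∣≡-[p-q] (⁻¹-anti-homo‿- p q))) q-p<r

frac-close : ∀ E A B A′ B′ → 0 < E → 0 < B → 0 < B′ →
             E * A * B′ < E * A′ * B + B * B′ → E * A′ * B < E * A * B′ + B′ * B →
             ∣ frac A B - frac A′ B′ ∣ <ℚ frac 1 E
frac-close E A B A′ B′ 0<E 0<B 0<B′ A/B<A′/B′+1/E A′/B′<A/B+1/E =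
  ∣p-q∣<r (frac A B) (frac A′ B′) (frac-sub-< E A B A′ B′ 0<E 0<B 0<B′ A/B<A′/B′+1/E)
                                  (frac-sub-< E A′ B′ A B 0<E 0<B′ 0<B A′/B′<A/B+1/E)

-- Solutions of the recurrence

module Recurrence {K} (x₀ : ℕ) (cs : Vec ℕ K) (0<x₀ : 0 < x₀) where

  private instance
    x₀-nonZero : NonZero x₀
    x₀-nonZero = >-nonZero 0<x₀

  L : ℕ
  L = suc K

  c : Vec ℕ L
  c = x₀ ∷ cs

  Recurrent : (ℕ → ℕ) → Set
  Recurrent X = ∀ n → L ≤ n → X (suc n) ≡ linComb (toList c) X n

  infix 4 _·_≤_·_on-window_
  record _·_≤_·_on-window_ (α : ℕ) (X : ℕ → ℕ) (β : ℕ) (Y : ℕ → ℕ) (t : ℕ) : Set where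
    constructor window
    field at : ∀ i → i < L → α * X (t ∸ i) ≤ β * Y (t ∸ i)
  open _·_≤_·_on-window_

  module _ {α β : ℕ} {X Y : ℕ → ℕ} where

    window-last : ∀ {t} → α · X ≤ β · Y on-window t → α * X t ≤ β * Y t
    window-last w = at w 0 (s≤s z≤n)

    window-extend : ∀ {t} → α · X ≤ β · Y on-window t → α * X (suc t) ≤ β * Y (suc t) →
                    α · X ≤ β · Y on-window suc t
    window-extend w next = window λ where
      zero    _         → next
      (suc i) (s≤s i<K) → at w i (m<n⇒m<1+n i<K)

    window-after : ∀ t → (∀ k → k ≤ L → α * X (k + t) ≤ β * Y (k + t)) → α · X ≤ β · Y on-window L + t
    window-after t ≤-after = window λ i i<L →
      subst (λ n → α * X n ≤ β * Y n) (sym (+-∸-comm t (<⇒≤ i<L))) (≤-after (L ∸ i) (m∸n≤m L i))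

  window-pos : ∀ {t i} → L ≤ t → i < L → 0 < t ∸ i
  window-pos L≤t i<L = m<n⇒0<n∸m (<-≤-trans i<L L≤t)

  module _ {X Y : ℕ → ℕ} (X-rec : Recurrent X) (Y-rec : Recurrent Y) {α β : ℕ} where

    -- c₁ ≥ 1 is what keeps a slack alive: the new term contains c₁ times the old one.
    slack-step : ∀ {t} z → L ≤ t → α · X ≤ β · Y on-window t →
                 α * X t + z ≤ β * Y t → α * X (suc t) + z ≤ β * Y (suc t)
    slack-step {t} z L≤t w slack = begin
      α * X (suc t) + z                   ≡⟨ cong (λ v → α * v + z) (X-rec t L≤t) ⟩
      α * (x₀ * X t + restX) + z          ≡⟨ expand α x₀ (X t) restX z ⟩
      x₀ * (α * X t) + α * restX + z      ≤⟨ +-monoʳ-≤ _ (m≤n*m z x₀) ⟩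
      x₀ * (α * X t) + α * restX + x₀ * z ≡⟨ regroup x₀ (α * X t) (α * restX) z ⟩
      x₀ * (α * X t + z) + α * restX      ≤⟨ +-mono-≤ (*-monoʳ-≤ x₀ slack) rest≤ ⟩
      x₀ * (β * Y t) + β * restY          ≡⟨ factor β x₀ (Y t) restY ⟩
      β * (x₀ * Y t + restY)              ≡⟨ cong (β *_) (Y-rec t L≤t) ⟨
      β * Y (suc t)                       ∎
      where
      open ≤-Reasoning
      restX restY : ℕ
      restX = linComb (toList cs) X (t ∸ 1)
      restY = linComb (toList cs) Y (t ∸ 1)
      expand : ∀ a x y r z → a * (x * y + r) + z ≡ x * (a * y) + a * r + z
      expand = solve-∀
      regroup : ∀ x u v z → x * u + v + x * z ≡ x * (u + z) + v
      regroup = solve-∀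
      factor : ∀ b x y r → x * (b * y) + b * r ≡ b * (x * y + r)
      factor = solve-∀
      rest≤ : α * restX ≤ β * restY
      rest≤ = subst₂ _≤_ (sym (*-distribˡ-linComb cs X α (t ∸ 1))) (sym (*-distribˡ-linComb cs Y β (t ∸ 1)))
        (linComb-mono cs (t ∸ 1) λ i i<K →
          subst (λ n → α * X n ≤ β * Y n) (sym (∸-+-assoc t 1 i)) (at w (suc i) (s≤s i<K)))

    window-step : ∀ {t} → L ≤ t → α · X ≤ β · Y on-window t → α · X ≤ β · Y on-window suc t
    window-step {t} L≤t w = window-extend w (subst (_≤ β * Y (suc t)) (+-identityʳ _)
      (slack-step 0 L≤t w (subst (_≤ β * Y t) (sym (+-identityʳ _)) (window-last w))))

    window-forever : ∀ {t} → L ≤ t → α · X ≤ β · Y on-window t → ∀ k → α · X ≤ β · Y on-window k + t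
    window-forever     L≤t w zero    = w
    window-forever {t} L≤t w (suc k) = window-step (≤-trans L≤t (m≤n+m t k)) (window-forever L≤t w k)

    slack-forever : ∀ {t} z → L ≤ t → α · X ≤ β · Y on-window t →
                    α * X t + z ≤ β * Y t → ∀ k → α * X (k + t) + z ≤ β * Y (k + t)
    slack-forever     z L≤t w slack zero    = slack
    slack-forever {t} z L≤t w slack (suc k) =
      slack-step z (≤-trans L≤t (m≤n+m t k)) (window-forever L≤t w k) (slack-forever z L≤t w slack k)

    dominates-from : ∀ {t} → L ≤ t → α · X ≤ β · Y on-window t → ∀ n → t ≤ n → α * X n ≤ β * Y n
    dominates-from {t} L≤t w n t≤n =
      subst (λ n → α * X n ≤ β * Y n) (m∸n+n≡m t≤n) (window-last (window-forever L≤t w (n ∸ t)))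

  S : ℕ
  S = sum (toList c)

  private instance
    S-nonZero : NonZero S
    S-nonZero = >-nonZero (≤-trans 0<x₀ (m≤m+n x₀ (sum (toList cs))))

  module _ {X : ℕ → ℕ} (X-rec : Recurrent X) where

    recurrent-mono : ∀ {s t} → L ≤ s → s ≤ t → X s ≤ X t
    recurrent-mono {s} {t} L≤s s≤t = subst (λ n → X s ≤ X n) (m∸n+n≡m s≤t) (mono-+ (t ∸ s))
      where
      mono-+ : ∀ k → X s ≤ X (k + s)
      mono-+ zero    = ≤-refl
      mono-+ (suc k) = begin
        X s                          ≤⟨ mono-+ k ⟩
        X (k + s)                    ≤⟨ m≤n*m (X (k + s)) x₀ ⟩
        x₀ * X (k + s)               ≤⟨ m≤m+n _ _ ⟩
        linComb (toList c) X (k + s) ≡⟨ X-rec (k + s) (≤-trans L≤s (m≤n+m s k)) ⟨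
        X (suc k + s)                ∎
        where open ≤-Reasoning

    recurrent-pos : (∀ i → 1 ≤ i → i ≤ L → 0 < X i) → ∀ n → 1 ≤ n → 0 < X n
    recurrent-pos X-init n 1≤n with n ≤? L
    ... | yes n≤L = X-init n 1≤n n≤L
    ... | no  n≰L = ≤-trans (X-init L (s≤s z≤n) ≤-refl) (recurrent-mono ≤-refl (<⇒≤ (≰⇒> n≰L)))

    recurrent-growth : ∀ {t} → L + L ≤ t → X (suc t) ≤ S * X t
    recurrent-growth {t} 2L≤t = begin
      X (suc t)                        ≡⟨ X-rec t (m+n≤o⇒m≤o L 2L≤t) ⟩
      linComb (toList c) X t           ≤⟨ linComb-mono c t (λ i i<L → recurrent-mono (L≤t∸i i<L) (m∸n≤m t i)) ⟩
      linComb (toList c) (λ _ → X t) t ≡⟨ linComb-const c (X t) t ⟩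
      S * X t                          ∎
      where
      open ≤-Reasoning
      L≤t∸i : ∀ {i} → i < L → L ≤ t ∸ i
      L≤t∸i i<L = m+n≤o⇒m≤o∸n L (≤-trans (+-monoʳ-≤ L (<⇒≤ i<L)) 2L≤t)

    recurrent-growth-^ : ∀ {t} → L + L ≤ t → ∀ k → X (k + t) ≤ S ^ k * X t
    recurrent-growth-^ {t} 2L≤t zero    = ≤-reflexive (sym (*-identityˡ (X t)))
    recurrent-growth-^ {t} 2L≤t (suc k) = begin
      X (suc k + t)     ≤⟨ recurrent-growth (≤-trans 2L≤t (m≤n+m t k)) ⟩
      S * X (k + t)     ≤⟨ *-monoʳ-≤ S (recurrent-growth-^ 2L≤t k) ⟩
      S * (S ^ k * X t) ≡⟨ *-assoc S (S ^ k) (X t) ⟨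
      S ^ suc k * X t   ∎
      where open ≤-Reasoning

    recurrent-growth-window : ∀ {t k} → L + L ≤ t → k ≤ L → X (k + t) ≤ S ^ L * X t
    recurrent-growth-window {t} {k} 2L≤t k≤L =
      ≤-trans (recurrent-growth-^ 2L≤t k) (*-monoˡ-≤ (X t) (^-monoʳ-≤ S k≤L))

  module Ratio {G H : ℕ → ℕ} (G-rec : Recurrent G) (H-rec : Recurrent H)
               (G-pos : ∀ n → 0 < n → 0 < G n) (H-pos : ∀ n → 0 < n → 0 < H n) where

    P M₁ M : ℕ
    P  = S ^ L
    M₁ = 2 * P
    M  = suc M₁

    -- A slack of d·Gₜ/2 at t is at least d·G/M on the next L indices, since G grows by at most P there.
    gap-spreads : ∀ {X Y} → Recurrent X → Recurrent Y → ∀ {α β} d {t} → L + L ≤ t →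
                  α · X ≤ β · Y on-window t → d * G t ≤ 2 * (β * Y t ∸ α * X t) →
                  ∀ k → k ≤ L → M * (α * X (k + t)) + d * G (k + t) ≤ M * (β * Y (k + t))
    gap-spreads {X} {Y} X-rec Y-rec {α} {β} d {t} 2L≤t w gap k k≤L = begin
      M * (α * X (k + t)) + d * G (k + t) ≤⟨ +-monoʳ-≤ (M * (α * X (k + t))) dG≤Mz ⟩
      M * (α * X (k + t)) + M * z         ≡⟨ *-distribˡ-+ M (α * X (k + t)) z ⟨
      M * (α * X (k + t) + z)             ≤⟨ *-monoʳ-≤ M (slack-forever X-rec Y-rec z L≤t w slack k) ⟩
      M * (β * Y (k + t))                 ∎
      where
      open ≤-Reasoning
      L≤t : L ≤ t
      L≤t = m+n≤o⇒m≤o L 2L≤t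
      z : ℕ
      z = β * Y t ∸ α * X t
      slack : α * X t + z ≤ β * Y t
      slack = ≤-reflexive (m+[n∸m]≡n (window-last w))
      dG≤Mz : d * G (k + t) ≤ M * z
      dG≤Mz = begin
        d * G (k + t) ≤⟨ *-monoʳ-≤ d (recurrent-growth-window G-rec 2L≤t k≤L) ⟩
        d * (P * G t) ≡⟨ x∙yz≈y∙xz d P (G t) ⟩
        P * (d * G t) ≤⟨ *-monoʳ-≤ P gap ⟩
        P * (2 * z)   ≡⟨ x∙yz≈y∙xz P 2 z ⟩
        2 * (P * z)   ≡⟨ *-assoc 2 P z ⟨
        M₁ * z        ≤⟨ m≤n+m (M₁ * z) z ⟩
        M * z         ∎

    Bracket : ℕ → ℕ → ℕ → ℕ → Set
    Bracket T a d t = a · G ≤ T · H on-window t × T · H ≤ (a + d) · G on-window t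

    bisect-above : ∀ {T a d t} → L + L ≤ t → Bracket T a d t → (2 * a + d) * G t ≤ 2 * (T * H t) →
                   Bracket (M * T) (M * a + d) (M₁ * d) (L + t)
    bisect-above {T} {a} {d} {t} 2L≤t (lower , upper) above = window-after t raised , window-after t kept
      where
      gap : d * G t ≤ 2 * (T * H t ∸ a * G t)
      gap = m+2n≤2o⇒m≤2[o∸n] (d * G t) (a * G t) (T * H t)
              (subst (_≤ 2 * (T * H t)) (e₁ a d (G t)) above)
        where
        e₁ : ∀ a d g → (2 * a + d) * g ≡ d * g + 2 * (a * g)
        e₁ = solve-∀
      raised : ∀ k → k ≤ L → (M * a + d) * G (k + t) ≤ M * T * H (k + t)
      raised k k≤L = subst₂ _≤_ (e₂ M a d (G (k + t))) (sym (*-assoc M T (H (k + t))))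
                       (gap-spreads G-rec H-rec d 2L≤t lower gap k k≤L)
        where
        e₂ : ∀ m a d g → m * (a * g) + d * g ≡ (m * a + d) * g
        e₂ = solve-∀
      kept : ∀ k → k ≤ L → M * T * H (k + t) ≤ (M * a + d + M₁ * d) * G (k + t)
      kept k k≤L = subst₂ _≤_ (sym (*-assoc M T (H (k + t)))) (e₃ M₁ a d (G (k + t)))
                     (*-monoʳ-≤ M (dominates-from H-rec G-rec (m+n≤o⇒m≤o L 2L≤t) upper (k + t) (m≤n+m t k)))
        where
        e₃ : ∀ m a d g → suc m * ((a + d) * g) ≡ (suc m * a + d + m * d) * g
        e₃ = solve-∀

    bisect-below : ∀ {T a d t} → L + L ≤ t → Bracket T a d t → 2 * (T * H t) ≤ (2 * a + d) * G t →
                   Bracket (M * T) (M * a) (M₁ * d) (L + t)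
    bisect-below {T} {a} {d} {t} 2L≤t (lower , upper) below = window-after t kept , window-after t lowered
      where
      gap : d * G t ≤ 2 * ((a + d) * G t ∸ T * H t)
      gap = m+2n≤2o⇒m≤2[o∸n] (d * G t) (T * H t) ((a + d) * G t) (begin
        d * G t + 2 * (T * H t)     ≤⟨ +-monoʳ-≤ (d * G t) below ⟩
        d * G t + (2 * a + d) * G t ≡⟨ e₁ a d (G t) ⟩
        2 * ((a + d) * G t)         ∎)
        where
        open ≤-Reasoning
        e₁ : ∀ a d g → d * g + (2 * a + d) * g ≡ 2 * ((a + d) * g)
        e₁ = solve-∀
      kept : ∀ k → k ≤ L → M * a * G (k + t) ≤ M * T * H (k + t)
      kept k k≤L = subst₂ _≤_ (sym (*-assoc M a (G (k + t)))) (sym (*-assoc M T (H (k + t))))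
                     (*-monoʳ-≤ M (dominates-from G-rec H-rec (m+n≤o⇒m≤o L 2L≤t) lower (k + t) (m≤n+m t k)))
      lowered : ∀ k → k ≤ L → M * T * H (k + t) ≤ (M * a + M₁ * d) * G (k + t)
      lowered k k≤L = +-cancelʳ-≤ (d * G (k + t)) _ _
        (subst₂ _≤_ (cong (_+ d * G (k + t)) (sym (*-assoc M T (H (k + t))))) (e₂ M₁ a d (G (k + t)))
          (gap-spreads H-rec G-rec d 2L≤t upper gap k k≤L))
        where
        e₂ : ∀ m a d g → suc m * ((a + d) * g) ≡ (suc m * a + m * d) * g + d * g
        e₂ = solve-∀

    bisect : ∀ {T a d t} → L + L ≤ t → Bracket T a d t → Σ ℕ λ a′ → Bracket (M * T) a′ (M₁ * d) (L + t)
    -- Compare Hₜ/Gₜ with the midpoint (2a + d)/2T of the bracket.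
    bisect {T} {a} {d} {t} 2L≤t b with (2 * a + d) * G t ≤? 2 * (T * H t)
    ... | yes above = M * a + d , bisect-above 2L≤t b above
    ... | no  below = M * a     , bisect-below 2L≤t b (<⇒≤ (≰⇒> below))

    t₀ D₀ : ℕ
    t₀ = L + L
    D₀ = proj₁ (bounded-up-to H t₀)

    initial-bracket : Bracket 1 0 D₀ t₀
    initial-bracket = window (λ _ _ → z≤n) , window λ i i<L →
      H≤D₀G (t₀ ∸ i) (m∸n≤m t₀ i) (window-pos (m≤m+n L L) i<L)
      where
      H≤D₀G : ∀ j → j ≤ t₀ → 0 < j → 1 * H j ≤ D₀ * G j
      H≤D₀G j j≤t₀ 0<j = begin
        1 * H j  ≡⟨ *-identityˡ (H j) ⟩
        H j      ≤⟨ proj₂ (bounded-up-to H t₀) j j≤t₀ ⟩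
        D₀       ≤⟨ m≤m*n D₀ (G j) {{>-nonZero (G-pos j 0<j)}} ⟩
        D₀ * G j ∎
        where open ≤-Reasoning

    bracket : ∀ k → Σ ℕ λ a → Bracket (M ^ k) a (M₁ ^ k * D₀) (k * L + t₀)
    bracket zero    = 0 , subst (λ d → Bracket 1 0 d t₀) (sym (*-identityˡ D₀)) initial-bracket
    bracket (suc k) with bracket k
    ... | a , b with bisect (m≤n+m t₀ (k * L)) b
    ...   | a′ , b′ =
      a′ , subst₂ (Bracket (M ^ suc k) a′) (sym (*-assoc M₁ (M₁ ^ k) D₀)) (sym (+-assoc L (k * L) t₀)) b′

    frac-cauchy : ∀ ε → 0ℚ <ℚ ε → Σ ℕ λ N → ∀ m n → N ≤ m → N ≤ n →
                  ∣ frac (H m) (G m) - frac (H n) (G n) ∣ <ℚ ε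
    frac-cauchy ε 0<ε with unitFraction-below ε 0<ε
    ... | e , 1/e≤ε with [1+m]^k-outgrows-m^k M₁ (suc e * D₀)
    ...   | k , small with bracket k
    ...     | a , (lower , upper) = N , λ m n N≤m N≤n →
      ℚ.<-≤-trans (frac-close (suc e) (H m) (G m) (H n) (G n) (s≤s z≤n) (G-pos′ N≤m) (G-pos′ N≤n)
                               (close N≤m N≤n) (close N≤n N≤m))
                  1/e≤ε
      where
      N : ℕ
      N = k * L + t₀
      L≤N : L ≤ N
      L≤N = ≤-trans (m≤m+n L L) (m≤n+m t₀ (k * L))
      G-pos′ : ∀ {m} → N ≤ m → 0 < G m
      G-pos′ N≤m = G-pos _ (≤-trans (s≤s z≤n) (≤-trans L≤N N≤m))
      narrow : suc e * (M₁ ^ k * D₀) < M ^ k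
      narrow = subst (_< M ^ k) (rearrange (suc e) D₀ (M₁ ^ k)) small
        where
        rearrange : ∀ E D p → E * D * p ≡ E * (p * D)
        rearrange = solve-∀
      close : ∀ {m n} → N ≤ m → N ≤ n → suc e * H m * G n < suc e * H n * G m + G m * G n
      close {m} {n} N≤m N≤n =
        bracketed-ratios-close (M ^ k) a (M₁ ^ k * D₀) (suc e) (G-pos′ N≤m) (G-pos′ N≤n) narrow
        (dominates-from H-rec G-rec L≤N upper m N≤m) (dominates-from G-rec H-rec L≤N lower n N≤n)

    frac-bounded-below : Σ ℚ λ δ → 0ℚ <ℚ δ × Σ ℕ λ N → ∀ n → N ≤ n → δ ≤ℚ frac (H n) (G n)
    frac-bounded-below = frac 1 (suc D) , frac-pos 1 (suc D) (s≤s z≤n) (s≤s z≤n) , L , λ n L≤n →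
      frac-≤ 1 (suc D) (H n) (G n) (s≤s z≤n) (G-pos n (≤-trans (s≤s z≤n) L≤n))
        (subst (1 * G n ≤_) (*-comm (suc D) (H n)) (dominates-from G-rec H-rec ≤-refl initial n L≤n))
      where
      D : ℕ
      D = proj₁ (bounded-up-to G L)
      initial : 1 · G ≤ suc D · H on-window L
      initial = window λ i i<L → begin
        1 * G (L ∸ i)     ≡⟨ *-identityˡ (G (L ∸ i)) ⟩
        G (L ∸ i)         ≤⟨ proj₂ (bounded-up-to G L) (L ∸ i) (m∸n≤m L i) ⟩
        D                 ≤⟨ n≤1+n D ⟩
        suc D             ≤⟨ m≤m*n (suc D) (H (L ∸ i)) {{>-nonZero (H-pos _ (window-pos ≤-refl i<L))}} ⟩
        suc D * H (L ∸ i) ∎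
        where open ≤-Reasoning

mainTheorem3 : (K : ℕ) (c : Vec ℕ (suc K)) → 1 ≤ head c → 1 ≤ last c →
    (G : ℕ → ℕ) → (∀ i → 1 ≤ i → i ≤ suc K → 0 < G i) →
    (∀ n → suc K ≤ n → G (suc n) ≡ linComb (toList c) G n) →
    (H : ℕ → ℕ) → CountsSuperLegal c H →
    (∀ (ε : ℚ) → 0ℚ <ℚ ε → Σ ℕ λ N → ∀ m n → N ≤ m → N ≤ n →
        ∣ frac (H m) (G m) - frac (H n) (G n) ∣ <ℚ ε)
    × Σ ℚ (λ δ → 0ℚ <ℚ δ × Σ ℕ λ N → ∀ n → N ≤ n → δ ≤ℚ frac (H n) (G n))
mainTheorem3 K (x₀ ∷ cs) 0<x₀ _ G G-init G-rec H counts = frac-cauchy , frac-bounded-below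
  where
  open Recurrence x₀ cs 0<x₀ using (recurrent-pos; module Ratio)
  open SuperLegalTuples.Counting x₀ cs 0<x₀ H counts using (count-recurrent; count-pos)
  open Ratio G-rec count-recurrent (recurrent-pos G-rec G-init) count-pos
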